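{- Let $\pi\in\mathsf{G}_{r,n}$ and $\text{A-code}(\pi)=(c_1^{[e_1]},\dots,c_n^{[e_n]})$. Then $$\ell(\pi)=\sum_{i=1}^n\Bigl(i-c_i+\chi(e_i>0)\cdot\bigl(2(c_i-1)+e_i\bigr)\Bigr),$$ where $\chi(A)=1$ if $A$ holds and $0$ otherwise.
   Context: $\Sigma=\{i^{[c]}:1\le i\le n,\ c\in\mathbb{Z}/r\mathbb{Z}\}$, colors identified with $0,\dots,r-1$. $\mathsf{G}_{r,n}$: group under composition of bijections $\pi$ of $\Sigma$ with $\pi(i^{[c]})=\sigma_i^{[z_i+c]}$, $\sigma\in\mathfrak S_n$; window $\pi=\sigma_1^{[z_1]}\cdots\sigma_n^{[z_n]}$. $\ell(\pi)$ is the minimal number of generators $s_0,\dots,s_{n-1}$ with product $\pi$, where $\pi s_i$ ($1\le i<n$) swaps the $i$-th and $(i+1)$-th window letters and $\pi s_0$ adds $1$ to the color of the first letter. A-code$(\pi)=(c_1^{[e_1]},\dots,c_n^{[e_n]})$ with $c_i=|\{j\le i:\sigma^{ -1}(j)\le\sigma^{ -1}(i)\}|$ and $e_i=z_{\sigma^{ -1}(i)}$. -}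

module Defs where

open import Data.Nat using (ℕ; zero; suc; _+_; _*_; _∸_; NonZero)
open import Data.Nat.DivMod using (_mod_)
open import Data.Fin using (Fin; toℕ; _≤?_)
open import Data.Fin.Permutation using (Permutation′; _⟨$⟩ʳ_; _⟨$⟩ˡ_)
open import Data.Product using (_×_; _,_; proj₁; proj₂; Σ)
open import Data.Vec using (Vec; []; _∷_; tabulate)
open import Data.List using (List; foldl; length; filter; allFin; map)
open import Data.Nat.ListAction using (sum)
open import Relation.Binary.PropositionalEquality using (_≡_)

-- A window letter σ_k^{[z_k]}: value (0-indexed: value i stands for i+1) and colour.
Letter : ℕ → ℕ → Set
Letter n r = Fin n × Fin r

Window : ℕ → ℕ → Set
Window n r = Vec (Letter n r) n

window : ∀ {n r} → Permutation′ n → (Fin n → Fin r) → Window n r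
window σ z = tabulate (λ k → (σ ⟨$⟩ʳ k , z k))

idWindow : ∀ n r .{{_ : NonZero r}} → Window n r
idWindow n r = tabulate (λ k → (k , 0 mod r))

bumpFirst : ∀ {n m r} .{{_ : NonZero r}} → Vec (Letter n r) m → Vec (Letter n r) m
bumpFirst {r = r} [] = []
bumpFirst {r = r} ((a , c) ∷ xs) = (a , (suc (toℕ c)) mod r) ∷ xs

swapAt : ∀ {A : Set} {m} → ℕ → Vec A m → Vec A m
swapAt zero (x ∷ y ∷ xs) = y ∷ x ∷ xs
swapAt (suc j) (x ∷ xs) = x ∷ swapAt j xs
swapAt _ xs = xs

-- right multiplication by generator s_i (i ∈ {0,…,n-1}):
-- π s_0 adds 1 to the colour of the first letter,
-- π s_i (1 ≤ i < n) swaps the i-th and (i+1)-th window letters.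
actGen : ∀ {n r} .{{_ : NonZero r}} → Window n r → Fin n → Window n r
actGen w i with toℕ i
... | zero = bumpFirst w
... | suc j = swapAt j w

wordWindow : ∀ n r .{{_ : NonZero r}} → List (Fin n) → Window n r
wordWindow n r ws = foldl actGen (idWindow n r) ws

IsLength : ∀ n r .{{_ : NonZero r}} → Window n r → ℕ → Set
IsLength n r π L =
  Σ (List (Fin n)) (λ ws → (wordWindow n r ws ≡ π) × (length ws ≡ L))
  × (∀ (ws : List (Fin n)) → wordWindow n r ws ≡ π → L Data.Nat.≤ length ws)

-- A-code letter c_i (i 0-indexed, so i stands for i+1):
-- c = |{ j ≤ i : σ⁻¹(j) ≤ σ⁻¹(i) }|
codeC : ∀ {n} → Permutation′ n → Fin n → ℕ
codeC {n} σ i =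
  length (filter (λ j → j ≤? i) (filter (λ j → (σ ⟨$⟩ˡ j) ≤? (σ ⟨$⟩ˡ i)) (allFin n)))

codeE : ∀ {n r} → Permutation′ n → (Fin n → Fin r) → Fin n → ℕ
codeE σ z i = toℕ (z (σ ⟨$⟩ˡ i))

χpos : ℕ → ℕ → ℕ
χpos zero x = 0
χpos (suc _) x = x

summand : ∀ {n r} → Permutation′ n → (Fin n → Fin r) → Fin n → ℕ
summand σ z i =
  (suc (toℕ i) ∸ codeC σ i)
    + χpos (codeE σ z i) (2 * (codeC σ i ∸ 1) + codeE σ z i)

lengthFormula : ∀ n r → Permutation′ n → (Fin n → Fin r) → ℕ
lengthFormula n r σ z = sum (map (summand σ z) (allFin n))

module Submission where

-- Read the closed form position by position: the letter at position p contributes its colour,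
-- the number of smaller letters to its right, and twice the number of larger coloured letters to
-- its right (the weight below). In the paper's form a coloured letter i instead carries twice the
-- c_i - 1 smaller letters to its left; swapping the resulting double sum gives the weight.
-- Every generator raises the weight by at most one and the identity has weight 0, so the weight
-- bounds the length from below. Conversely a window of positive weight has a generator lowering
-- the weight by exactly one: take one unit of colour off a coloured first letter, or else swap the
-- first adjacent pair that is an inversion or ends in a coloured letter.

open import Defs
open import Data.Bool using (if_then_else_)
open import Data.Empty using (⊥-elim)
open import Data.Fin using (Fin; toℕ; fromℕ<; inject₁) renaming (zero to fzero; suc to fsuc)
import Data.Fin as Fin
open import Data.Fin.Permutation using (Permutation′; _⟨$⟩ʳ_; _⟨$⟩ˡ_; inverseˡ)
open import Data.Fin.Properties using (toℕ-injective; toℕ<n; toℕ-fromℕ<; toℕ-inject₁)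
open import Data.List using (List; []; _∷_; _∷ʳ_; foldl; length; filter; map; allFin)
import Data.List as List
open import Data.List.Properties using (foldl-∷ʳ; length-++)
open import Data.Nat using (ℕ; zero; suc; _+_; _*_; _∸_; _≤_; _<_; z≤n; s≤s; s≤s⁻¹; z<s; NonZero; >-nonZero⁻¹)
open import Data.Nat.DivMod using (_mod_; _%_; m<n⇒m%n≡m; m%n≤m)
open import Data.Nat.ListAction using (sum)
open import Data.Nat.Properties
open import Algebra.Properties.Semiring.Sum +-*-semiring
  using (sum-syntax; sum-cong-≗; ∑-distrib-+; ∑-comm; ∑-permute; *-distribˡ-sum; sum-replicate-zero)
  renaming (sum to ∑)
open import Data.Nat.Solver using (module +-*-Solver)
open import Data.Product using (_×_; _,_; proj₁; proj₂; Σ)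
open import Data.Sum using (_⊎_; inj₁; inj₂)
open import Data.Vec using (Vec; []; _∷_; tabulate)
open import Data.Vec.Relation.Unary.All as All using (All; []; _∷_)
open import Data.Vec.Relation.Unary.All.Properties using (tabulate⁺)
open import Data.Vec.Relation.Unary.AllPairs using (AllPairs; []; _∷_)
import Data.Vec.Relation.Unary.AllPairs.Properties as AllPairs
open import Relation.Binary.Core using (Rel)
open import Relation.Binary.Definitions using (Symmetric; tri<; tri≈; tri>)
open import Relation.Binary.PropositionalEquality
  using (_≡_; _≢_; ≢-sym; refl; sym; trans; cong; cong₂; subst; subst₂; module ≡-Reasoning)
open import Relation.Nullary using (Dec; does; yes; no; ¬_)
open +-*-Solver using (solve; _:+_; _:*_; _:=_; con)

[_<_] : ℕ → ℕ → ℕ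
[ zero  < suc _ ] = 1
[ _     < zero  ] = 0
[ suc a < suc b ] = [ a < b ]

[<]≡1 : ∀ {a b} → a < b → [ a < b ] ≡ 1
[<]≡1 {zero}  {suc b} _       = refl
[<]≡1 {suc a} {suc b} (s≤s p) = [<]≡1 p

[<]≡0 : ∀ {a b} → b ≤ a → [ a < b ] ≡ 0
[<]≡0 {zero}  {zero}  _       = refl
[<]≡0 {suc a} {zero}  _       = refl
[<]≡0 {suc a} {suc b} (s≤s p) = [<]≡0 p

[<]≡0⇒≥ : ∀ {a b} → [ a < b ] ≡ 0 → b ≤ a
[<]≡0⇒≥ {a}     {zero}  _ = z≤n
[<]≡0⇒≥ {suc a} {suc b} e = s≤s ([<]≡0⇒≥ e)

sgn : ℕ → ℕ
sgn zero    = 0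
sgn (suc _) = 1

sgn≤1 : ∀ e → sgn e ≤ 1
sgn≤1 zero    = z≤n
sgn≤1 (suc _) = s≤s z≤n

sgn≢0 : ∀ {e} → e ≢ 0 → sgn e ≡ 1
sgn≢0 {zero}  e≢0 = ⊥-elim (e≢0 refl)
sgn≢0 {suc _} _   = refl

χpos-+ : ∀ e x → χpos e (x + e) ≡ sgn e * x + e
χpos-+ zero    x = refl
χpos-+ (suc e) x = cong (_+ suc e) (sym (*-identityˡ x))

𝟙 : ∀ {P : Set} → Dec P → ℕ
𝟙 d = if does d then 1 else 0

𝟙-yes : ∀ {P : Set} (d : Dec P) → P → 𝟙 d ≡ 1
𝟙-yes (yes _) _ = refl
𝟙-yes (no ¬p) p = ⊥-elim (¬p p)

𝟙-no : ∀ {P : Set} (d : Dec P) → ¬ P → 𝟙 d ≡ 0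
𝟙-no (yes p) ¬p = ⊥-elim (¬p p)
𝟙-no (no _)  _  = refl

length-filter≡sum : ∀ {A : Set} {P : A → Set} (P? : ∀ x → Dec (P x)) (xs : List A) →
                    length (filter P? xs) ≡ sum (map (λ x → 𝟙 (P? x)) xs)
length-filter≡sum P? []       = refl
length-filter≡sum P? (x ∷ xs) with P? x
... | yes _ = cong suc (length-filter≡sum P? xs)
... | no _  = length-filter≡sum P? xs

sum-map-filter : ∀ {A : Set} {P : A → Set} (P? : ∀ x → Dec (P x)) (f : A → ℕ) (xs : List A) →
                 sum (map f (filter P? xs)) ≡ sum (map (λ x → 𝟙 (P? x) * f x) xs)
sum-map-filter P? f []       = refl
sum-map-filter P? f (x ∷ xs) with P? x
... | yes _ = cong₂ _+_ (sym (*-identityˡ (f x))) (sum-map-filter P? f xs)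
... | no _  = sum-map-filter P? f xs

𝟙-≤?-≢ : ∀ {m} {a b : Fin m} → a ≢ b → 𝟙 (a Fin.≤? b) ≡ [ toℕ a < toℕ b ]
𝟙-≤?-≢ {a = a} {b} a≢b with <-cmp (toℕ a) (toℕ b)
... | tri< a<b _ _ = trans (𝟙-yes (a Fin.≤? b) (<⇒≤ a<b)) (sym ([<]≡1 a<b))
... | tri≈ _ a≡b _ = ⊥-elim (a≢b (toℕ-injective a≡b))
... | tri> _ _ b<a = trans (𝟙-no (a Fin.≤? b) (<⇒≱ b<a)) (sym ([<]≡0 (<⇒≤ b<a)))

sum-map-tabulate : ∀ {A : Set} {m} (f : A → ℕ) (g : Fin m → A) →
                   sum (map f (List.tabulate g)) ≡ ∑[ i < m ] f (g i)
sum-map-tabulate {m = zero}  f g = refl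
sum-map-tabulate {m = suc m} f g = cong (f (g fzero) +_) (sum-map-tabulate f (λ i → g (fsuc i)))

∑-𝟙-≟ : ∀ {m} (p : Fin m) → ∑[ k < m ] 𝟙 (k Fin.≟ p) ≡ 1
∑-𝟙-≟ {suc m} fzero    = cong suc (sum-replicate-zero m)
∑-𝟙-≟ {suc m} (fsuc p) = ∑-𝟙-≟ p

∑-[<]≡ : ∀ m {v} → v ≤ m → ∑[ j < m ] [ toℕ j < v ] ≡ v
∑-[<]≡ zero    z≤n     = refl
∑-[<]≡ (suc m) z≤n     = sum-replicate-zero m
∑-[<]≡ (suc m) (s≤s v≤m) = cong suc (∑-[<]≡ m v≤m)

⟨$⟩ʳ-injective : ∀ {n} (π : Permutation′ n) {i j} → π ⟨$⟩ʳ i ≡ π ⟨$⟩ʳ j → i ≡ j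
⟨$⟩ʳ-injective π e = trans (sym (inverseˡ π)) (trans (cong (π ⟨$⟩ˡ_) e) (inverseˡ π))

sumBy : ∀ {A : Set} {m} → (A → ℕ) → Vec A m → ℕ
sumBy f []       = 0
sumBy f (x ∷ xs) = f x + sumBy f xs

sumBy-swapAt : ∀ {A : Set} {m} (f : A → ℕ) j (w : Vec A m) → sumBy f (swapAt j w) ≡ sumBy f w
sumBy-swapAt f zero    []           = refl
sumBy-swapAt f zero    (x ∷ [])     = refl
sumBy-swapAt f zero    (x ∷ y ∷ xs) = solve 3 (λ a b c → b :+ (a :+ c) := a :+ (b :+ c)) refl (f x) (f y) (sumBy f xs)
sumBy-swapAt f (suc j) []           = refl
sumBy-swapAt f (suc j) (x ∷ xs)     = cong (f x +_) (sumBy-swapAt f j xs)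

sumBy-tabulate : ∀ {A : Set} {m} (f : A → ℕ) (g : Fin m → A) → sumBy f (tabulate g) ≡ ∑[ i < m ] f (g i)
sumBy-tabulate {m = zero}  f g = refl
sumBy-tabulate {m = suc m} f g = cong (f (g fzero) +_) (sumBy-tabulate f (λ i → g (fsuc i)))

sumBy-zero : ∀ {A : Set} {m} (f : A → ℕ) {w : Vec A m} → All (λ y → f y ≡ 0) w → sumBy f w ≡ 0
sumBy-zero f []       = refl
sumBy-zero f (p ∷ ps) rewrite p = sumBy-zero f ps

sumBy≡0⇒all : ∀ {A : Set} {m} (f : A → ℕ) (w : Vec A m) → sumBy f w ≡ 0 → All (λ y → f y ≡ 0) w
sumBy≡0⇒all f []       _ = []
sumBy≡0⇒all f (x ∷ xs) e = m+n≡0⇒m≡0 (f x) e ∷ sumBy≡0⇒all f xs (m+n≡0⇒n≡0 (f x) e)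

swapAt-involutive : ∀ {A : Set} {m} j (w : Vec A m) → swapAt j (swapAt j w) ≡ w
swapAt-involutive zero    []           = refl
swapAt-involutive zero    (x ∷ [])     = refl
swapAt-involutive zero    (x ∷ y ∷ xs) = refl
swapAt-involutive (suc j) []           = refl
swapAt-involutive (suc j) (x ∷ xs)     = cong (x ∷_) (swapAt-involutive j xs)

All-swapAt : ∀ {A : Set} {P : A → Set} {m} j {w : Vec A m} → All P w → All P (swapAt j w)
All-swapAt zero    []           = []
All-swapAt zero    (p ∷ [])     = p ∷ []
All-swapAt zero    (p ∷ q ∷ ps) = q ∷ p ∷ ps
All-swapAt (suc j) []           = []
All-swapAt (suc j) (p ∷ ps)     = p ∷ All-swapAt j ps

AllPairs-swapAt : ∀ {A : Set} {R : Rel A _} {m} → Symmetric R →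
                  ∀ j {w : Vec A m} → AllPairs R w → AllPairs R (swapAt j w)
AllPairs-swapAt sym zero    []                       = []
AllPairs-swapAt sym zero    (p ∷ [])                 = p ∷ []
AllPairs-swapAt sym zero    ((rxy ∷ rx) ∷ ry ∷ rs)   = (sym rxy ∷ ry) ∷ rx ∷ rs
AllPairs-swapAt sym (suc j) []                       = []
AllPairs-swapAt sym (suc j) (rx ∷ rs)                = All-swapAt j rx ∷ AllPairs-swapAt sym j rs

toℕ-0mod : ∀ r .{{_ : NonZero r}} → toℕ (0 mod r) ≡ 0
toℕ-0mod r = trans (toℕ-fromℕ< _) (m<n⇒m%n≡m (>-nonZero⁻¹ r))

actGen-swapAt : ∀ {n r} .{{_ : NonZero r}} (w : Window n r) (i : Fin n) j → toℕ i ≡ suc j → actGen w i ≡ swapAt j w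
actGen-swapAt w i j e with toℕ i
actGen-swapAt w i j refl | .(suc j) = refl

bumpFirst-inject₁ : ∀ {n m r} (a : Fin n) (c : Fin r) (xs : Vec (Letter n (suc r)) m) →
                    bumpFirst ((a , inject₁ c) ∷ xs) ≡ (a , fsuc c) ∷ xs
bumpFirst-inject₁ {r = r} a c xs = cong (λ c′ → (a , c′) ∷ xs) (toℕ-injective (begin
  toℕ (suc (toℕ (inject₁ c)) mod suc r) ≡⟨ toℕ-fromℕ< _ ⟩
  suc (toℕ (inject₁ c)) % suc r         ≡⟨ cong (λ t → suc t % suc r) (toℕ-inject₁ c) ⟩
  suc (toℕ c) % suc r                   ≡⟨ m<n⇒m%n≡m (s≤s (toℕ<n c)) ⟩
  suc (toℕ c)                           ∎))
  where open ≡-Reasoning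

module _ {n r : ℕ} where

  val col : Letter n r → ℕ
  val x = toℕ (proj₁ x)
  col x = toℕ (proj₂ x)

  smallerAfter largerColouredAfter : ∀ {m} → ℕ → Vec (Letter n r) m → ℕ
  smallerAfter        v = sumBy (λ y → [ val y < v ])
  largerColouredAfter v = sumBy (λ y → [ v < val y ] * sgn (col y))

  letterWeight : ∀ {m} → Letter n r → Vec (Letter n r) m → ℕ
  letterWeight x xs = col x + smallerAfter (val x) xs + 2 * largerColouredAfter (val x) xs

  -- The right-hand side of the theorem, computed from the window position by position.
  weight : ∀ {m} → Vec (Letter n r) m → ℕ
  weight []       = 0
  weight (x ∷ xs) = letterWeight x xs + weight xs

  pairWeight : Letter n r → Letter n r → ℕ
  pairWeight a b = [ val b < val a ] + 2 * ([ val a < val b ] * sgn (col b))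

  weight-∷-∷ : ∀ {m} a b (xs : Vec (Letter n r) m) →
               weight (a ∷ b ∷ xs) ≡ pairWeight a b + (letterWeight a xs + letterWeight b xs + weight xs)
  weight-∷-∷ a b xs =
    solve 9 (λ ca p la g ga cb lb gb s →
        ca :+ (p :+ la) :+ con 2 :* (g :+ ga) :+ (cb :+ lb :+ con 2 :* gb :+ s)
        := p :+ con 2 :* g :+ ((ca :+ la :+ con 2 :* ga) :+ (cb :+ lb :+ con 2 :* gb) :+ s)) refl
      (col a) ([ val b < val a ]) (smallerAfter (val a) xs) ([ val a < val b ] * sgn (col b))
      (largerColouredAfter (val a) xs) (col b) (smallerAfter (val b) xs) (largerColouredAfter (val b) xs)
      (weight xs)

  weight-swap-∷-∷ : ∀ {m} a b (xs : Vec (Letter n r) m) →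
                    weight (b ∷ a ∷ xs) ≡ pairWeight b a + (letterWeight a xs + letterWeight b xs + weight xs)
  weight-swap-∷-∷ a b xs = trans (weight-∷-∷ b a xs)
    (cong (λ t → pairWeight b a + (t + weight xs)) (+-comm (letterWeight b xs) (letterWeight a xs)))

  pairWeight-swap-≤ : ∀ a b → pairWeight b a ≤ suc (pairWeight a b)
  pairWeight-swap-≤ a b with <-cmp (val a) (val b)
  ... | tri< a<b _ _ rewrite [<]≡1 a<b | [<]≡0 (<⇒≤ a<b) = s≤s z≤n
  ... | tri≈ _ a≡b _ rewrite a≡b | [<]≡0 (≤-refl {val b}) = z≤n
  ... | tri> _ _ b<a rewrite [<]≡1 b<a | [<]≡0 (<⇒≤ b<a) =
    *-monoʳ-≤ 2 (≤-trans (≤-reflexive (+-identityʳ (sgn (col a)))) (sgn≤1 (col a)))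

  letterWeight-swapAt : ∀ {m} x j (xs : Vec (Letter n r) m) → letterWeight x (swapAt j xs) ≡ letterWeight x xs
  letterWeight-swapAt x j xs = cong₂ (λ u v → col x + u + 2 * v)
    (sumBy-swapAt (λ y → [ val y < val x ]) j xs) (sumBy-swapAt (λ y → [ val x < val y ] * sgn (col y)) j xs)

  weight-swapAt-≤ : ∀ {m} j (w : Vec (Letter n r) m) → weight (swapAt j w) ≤ suc (weight w)
  weight-swapAt-≤ zero    []           = z≤n
  weight-swapAt-≤ zero    (x ∷ [])     = n≤1+n _
  weight-swapAt-≤ zero    (a ∷ b ∷ xs) rewrite weight-swap-∷-∷ a b xs | weight-∷-∷ a b xs =
    +-monoˡ-≤ _ (pairWeight-swap-≤ a b)
  weight-swapAt-≤ (suc j) []           = z≤n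
  weight-swapAt-≤ (suc j) (x ∷ xs) rewrite letterWeight-swapAt x j xs =
    ≤-trans (+-monoʳ-≤ (letterWeight x xs) (weight-swapAt-≤ j xs)) (≤-reflexive (+-suc _ _))

  weight-bumpFirst-≤ : ∀ {m} .{{_ : NonZero r}} (w : Vec (Letter n r) m) → weight (bumpFirst w) ≤ suc (weight w)
  weight-bumpFirst-≤ []             = z≤n
  weight-bumpFirst-≤ ((a , c) ∷ xs) =
    +-monoˡ-≤ (weight xs) (+-monoˡ-≤ _ (+-monoˡ-≤ _ (≤-trans (≤-reflexive (toℕ-fromℕ< _)) (m%n≤m (suc (toℕ c)) r))))

  weight-actGen-≤ : .{{_ : NonZero r}} (w : Window n r) (i : Fin n) → weight (actGen w i) ≤ suc (weight w)
  weight-actGen-≤ w i with toℕ i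
  ... | zero  = weight-bumpFirst-≤ w
  ... | suc j = weight-swapAt-≤ j w

  weight-foldl-≤ : .{{_ : NonZero r}} (w : Window n r) (ws : List (Fin n)) →
                   weight (foldl actGen w ws) ≤ weight w + length ws
  weight-foldl-≤ w []       = ≤-reflexive (sym (+-identityʳ _))
  weight-foldl-≤ w (i ∷ ws) = begin
    weight (foldl actGen (actGen w i) ws) ≤⟨ weight-foldl-≤ (actGen w i) ws ⟩
    weight (actGen w i) + length ws       ≤⟨ +-monoˡ-≤ (length ws) (weight-actGen-≤ w i) ⟩
    suc (weight w) + length ws            ≡⟨ +-suc (weight w) (length ws) ⟨
    weight w + length (i ∷ ws)            ∎
    where open ≤-Reasoning

  Increasing Distinct : ∀ {m} → Vec (Letter n r) m → Set
  Increasing = AllPairs (λ x y → val x < val y)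
  Distinct   = AllPairs (λ x y → val x ≢ val y)

  Colourless : ∀ {m} → Vec (Letter n r) m → Set
  Colourless = All (λ y → col y ≡ 0)

  increasing⇒weight≡0 : ∀ {m} {w : Vec (Letter n r) m} → Increasing w → Colourless w → weight w ≡ 0
  increasing⇒weight≡0 []                       []       = refl
  increasing⇒weight≡0 {w = x ∷ xs} (x< ∷ inc) (c ∷ cs) = begin
    col x + smallerAfter (val x) xs + 2 * largerColouredAfter (val x) xs + weight xs
      ≡⟨ cong₂ (λ u v → col x + u + 2 * v + weight xs)
           (sumBy-zero _ (All.map (λ p → [<]≡0 (<⇒≤ p)) x<))
           (sumBy-zero _ (All.map (λ {y} cy → trans (cong (λ t → [ val x < val y ] * sgn t) cy) (*-zeroʳ [ val x < val y ])) cs)) ⟩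
    col x + 0 + 2 * 0 + weight xs
      ≡⟨ cong₂ (λ u v → u + 0 + 2 * 0 + v) c (increasing⇒weight≡0 inc cs) ⟩
    0 ∎
    where open ≡-Reasoning

  weight≡0⇒increasing : ∀ {m} {w : Vec (Letter n r) m} → Distinct w → weight w ≡ 0 → Increasing w × Colourless w
  weight≡0⇒increasing {w = []}     []         _ = [] , []
  weight≡0⇒increasing {w = x ∷ xs} (x≢ ∷ dis) e =
    let head≡0 = m+n≡0⇒m≡0 (letterWeight x xs) e
        col+smaller≡0 = m+n≡0⇒m≡0 (col x + smallerAfter (val x) xs) head≡0
        smaller≡0 = m+n≡0⇒n≡0 (col x) col+smaller≡0
        inc , cs = weight≡0⇒increasing dis (m+n≡0⇒n≡0 (letterWeight x xs) e)
    in All.map (λ (y≮x , x≢y) → ≤∧≢⇒< ([<]≡0⇒≥ y≮x) x≢y) (All.zip (sumBy≡0⇒all _ xs smaller≡0 , x≢)) ∷ inc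
       , m+n≡0⇒m≡0 (col x) col+smaller≡0 ∷ cs

  Descent : ∀ {m} → Vec (Letter n r) m → Set
  Descent {m} w = Σ ℕ λ j → suc j < m × suc (weight (swapAt j w)) ≡ weight w

  descent-∷-∷ : ∀ {m} a b (xs : Vec (Letter n r) m) → suc (pairWeight b a) ≡ pairWeight a b → Descent (a ∷ b ∷ xs)
  descent-∷-∷ a b xs e =
    0 , s≤s (s≤s z≤n) , (begin
    suc (weight (b ∷ a ∷ xs))    ≡⟨ cong suc (weight-swap-∷-∷ a b xs) ⟩
    suc (pairWeight b a) + rest  ≡⟨ cong (_+ rest) e ⟩
    pairWeight a b + rest        ≡⟨ weight-∷-∷ a b xs ⟨
    weight (a ∷ b ∷ xs)          ∎)
    where
      open ≡-Reasoning
      rest = letterWeight a xs + letterWeight b xs + weight xs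

  descent-∷ : ∀ {m} x {xs : Vec (Letter n r) m} → Descent xs → Descent (x ∷ xs)
  descent-∷ x {xs} (j , j<m , e) = suc j , s≤s j<m , (begin
    suc (letterWeight x (swapAt j xs) + weight (swapAt j xs)) ≡⟨ cong (λ t → suc (t + weight (swapAt j xs))) (letterWeight-swapAt x j xs) ⟩
    suc (letterWeight x xs + weight (swapAt j xs))            ≡⟨ +-suc (letterWeight x xs) _ ⟨
    letterWeight x xs + suc (weight (swapAt j xs))            ≡⟨ cong (letterWeight x xs +_) e ⟩
    letterWeight x xs + weight xs                             ∎)
    where open ≡-Reasoning

  descent-or-increasing : ∀ {m} x (xs : Vec (Letter n r) m) → col x ≡ 0 → Distinct (x ∷ xs) →
                          Descent (x ∷ xs) ⊎ (Increasing (x ∷ xs) × Colourless (x ∷ xs))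
  descent-or-increasing x []       cx _ = inj₂ ([] ∷ [] , cx ∷ [])
  descent-or-increasing x (y ∷ ys) cx ((x≢y ∷ _) ∷ dis) with <-cmp (val x) (val y) | col y ≟ 0
  ... | tri≈ _ x≡y _ | _ = ⊥-elim (x≢y x≡y)
  ... | tri> _ _ y<x | _ = inj₁ (descent-∷-∷ x y ys eq)
    where eq : suc (pairWeight y x) ≡ pairWeight x y
          eq rewrite [<]≡1 y<x | [<]≡0 (<⇒≤ y<x) | cx = refl
  ... | tri< x<y _ _ | no cy≢0 = inj₁ (descent-∷-∷ x y ys eq)
    where eq : suc (pairWeight y x) ≡ pairWeight x y
          eq rewrite [<]≡1 x<y | [<]≡0 (<⇒≤ x<y) | sgn≢0 cy≢0 = refl
  ... | tri< x<y _ _ | yes cy with descent-or-increasing y ys cy dis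
  ...   | inj₁ d               = inj₁ (descent-∷ x d)
  ...   | inj₂ (y< ∷ inc , cs) = inj₂ ((x<y ∷ All.map (<-trans x<y) y<) ∷ y< ∷ inc , cx ∷ cs)

  letter-≡ : ∀ {x y : Letter n r} → val x ≡ val y → col x ≡ col y → x ≡ y
  letter-≡ {_ , _} {_ , _} v c = cong₂ _,_ (toℕ-injective v) (toℕ-injective c)

  increasing-bound : ∀ {m} x (xs : Vec (Letter n r) m) → Increasing (x ∷ xs) → val x + m < n
  increasing-bound x []                         _ = subst (_< n) (sym (+-identityʳ (val x))) (toℕ<n (proj₁ x))
  increasing-bound {suc m} x (y ∷ ys) ((x<y ∷ _) ∷ inc) = begin-strict
    val x + suc m   ≡⟨ +-suc (val x) m ⟩
    suc (val x) + m ≤⟨ +-monoˡ-≤ m x<y ⟩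
    val y + m       <⟨ increasing-bound y ys inc ⟩
    n               ∎
    where open ≤-Reasoning

  tabulate-increasing : ∀ {m} b (g : Fin m → Letter n r) → (∀ k → val (g k) ≡ b + toℕ k) →
                        Increasing (tabulate g)
  tabulate-increasing {zero}  b g vg = []
  tabulate-increasing {suc m} b g vg =
    tabulate⁺ (λ k → subst₂ _<_ (sym (trans (vg fzero) (+-identityʳ b))) (sym (vg (fsuc k))) (m<m+n b z<s))
    ∷ tabulate-increasing (suc b) (λ k → g (fsuc k)) (λ k → trans (vg (fsuc k)) (+-suc b (toℕ k)))

  increasing-pinned : ∀ {m} b (g : Fin m → Letter n r) → (∀ k → val (g k) ≡ b + toℕ k) → (∀ k → col (g k) ≡ 0) →
                      b + m ≡ n → {w : Vec (Letter n r) m} →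
                      All (λ y → b ≤ val y) w → Increasing w → Colourless w → w ≡ tabulate g
  increasing-pinned b g vg cg b+m≡n {[]} _ _ _ = refl
  increasing-pinned {suc m} b g vg cg b+m≡n {x ∷ xs} (b≤x ∷ _) inc@(x< ∷ inc′) (cx ∷ cs) =
    cong₂ _∷_ (letter-≡ (trans x≡b (sym (trans (vg fzero) (+-identityʳ b)))) (trans cx (sym (cg fzero))))
      (increasing-pinned (suc b) (λ k → g (fsuc k)) (λ k → trans (vg (fsuc k)) (+-suc b (toℕ k))) (λ k → cg (fsuc k))
        (trans (sym (+-suc b m)) b+m≡n) (All.map (subst (_< _) x≡b) x<) inc′ cs)
    where
      x≡b : val x ≡ b
      x≡b = ≤-antisym (+-cancelʳ-≤ m (val x) b
              (s≤s⁻¹ (subst (val x + m <_) (trans (sym b+m≡n) (+-suc b m)) (increasing-bound x xs inc)))) b≤x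

  positionWeight : ∀ {m} → (Fin m → Letter n r) → Fin m → ℕ
  positionWeight {m} h p = col (h p) + (∑[ k < m ] ([ toℕ p < toℕ k ] * [ val (h k) < val (h p) ]))
                         + 2 * (∑[ k < m ] ([ toℕ p < toℕ k ] * [ val (h p) < val (h k) ] * sgn (col (h k))))

  weight-tabulate : ∀ {m} (h : Fin m → Letter n r) → weight (tabulate h) ≡ ∑[ p < m ] positionWeight h p
  weight-tabulate {zero}  h = refl
  weight-tabulate {suc m} h = cong₂ _+_ head (weight-tabulate (λ k → h (fsuc k)))
    where
      x = h fzero
      head : letterWeight x (tabulate (λ k → h (fsuc k))) ≡ positionWeight h fzero
      head = cong₂ (λ u v → col x + u + 2 * v)
        (trans (sumBy-tabulate (λ y → [ val y < val x ]) (λ k → h (fsuc k)))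
               (sum-cong-≗ λ k → sym (*-identityˡ [ val (h (fsuc k)) < val x ])))
        (trans (sumBy-tabulate (λ y → [ val x < val y ] * sgn (col y)) (λ k → h (fsuc k)))
               (sum-cong-≗ λ k → cong (_* sgn (col (h (fsuc k)))) (sym (*-identityˡ [ val x < val (h (fsuc k)) ]))))

module _ {n r : ℕ} .{{_ : NonZero r}} where

  identityLetter : Fin n → Letter n r
  identityLetter k = k , 0 mod r

  weight-identity : weight (idWindow n r) ≡ 0
  weight-identity = increasing⇒weight≡0 (tabulate-increasing 0 identityLetter (λ _ → refl)) (tabulate⁺ (λ _ → toℕ-0mod r))

  increasing⇒identity : {w : Window n r} → Increasing w → Colourless w → w ≡ idWindow n r
  increasing⇒identity {w} = increasing-pinned 0 identityLetter (λ _ → refl) (λ _ → toℕ-0mod r) refl (All.universal (λ _ → z≤n) w)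

  weight-wordWindow-≤ : (ws : List (Fin n)) → weight (wordWindow n r ws) ≤ length ws
  weight-wordWindow-≤ ws = subst (λ s → weight (wordWindow n r ws) ≤ s + length ws) weight-identity
                                 (weight-foldl-≤ (idWindow n r) ws)

  HasWord : Window n r → ℕ → Set
  HasWord w k = Σ (List (Fin n)) λ ws → wordWindow n r ws ≡ w × length ws ≡ k

  hasWord-actGen : ∀ {w k} i → HasWord w k → HasWord (actGen w i) (suc k)
  hasWord-actGen i (ws , ws≡w , ∣ws∣≡k) =
    ws ∷ʳ i
    , trans (foldl-∷ʳ actGen (idWindow n r) i ws) (cong (λ v → actGen v i) ws≡w)
    , trans (length-++ ws) (trans (+-comm (length ws) 1) (cong suc ∣ws∣≡k))

hasWord-weight : ∀ {n r} .{{_ : NonZero r}} k (w : Window n r) → Distinct w → weight w ≡ k → HasWord w k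
hasWord-weight zero w dis e =
  let inc , cs = weight≡0⇒increasing dis e in [] , sym (increasing⇒identity inc cs) , refl
hasWord-weight (suc k) ((a , fsuc c) ∷ xs) (a≢ ∷ dis) e =
  subst (λ v → HasWord v (suc k)) (bumpFirst-inject₁ a c xs)
    (hasWord-actGen fzero (hasWord-weight k ((a , inject₁ c) ∷ xs) (a≢ ∷ dis) uncoloured-weight))
  where
    uncoloured-weight : weight ((a , inject₁ c) ∷ xs) ≡ k
    uncoloured-weight = suc-injective (trans
      (cong (λ t → suc (t + smallerAfter (toℕ a) xs + 2 * largerColouredAfter (toℕ a) xs + weight xs)) (toℕ-inject₁ c))
      e)
hasWord-weight (suc k) w@((a , fzero) ∷ xs) dis e with descent-or-increasing (a , fzero) xs refl dis
... | inj₂ (inc , cs) with () ← trans (sym e) (increasing⇒weight≡0 inc cs)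
... | inj₁ (j , j<n , drop) =
  subst (λ v → HasWord v (suc k)) (trans (actGen-swapAt _ i j (toℕ-fromℕ< j<n)) (swapAt-involutive j w))
    (hasWord-actGen i (hasWord-weight k (swapAt j w) (AllPairs-swapAt ≢-sym j dis) (suc-injective (trans drop e))))
  where i = fromℕ< j<n

module _ {n r : ℕ} (σ : Permutation′ n) (z : Fin n → Fin r) where

  σℕ zℕ : Fin n → ℕ
  σℕ k = toℕ (σ ⟨$⟩ʳ k)
  zℕ k = toℕ (z k)

  nonInversion inversion : Fin n → Fin n → ℕ
  nonInversion i j = [ toℕ i < toℕ j ] * [ σℕ i < σℕ j ]
  inversion    i j = [ toℕ i < toℕ j ] * [ σℕ j < σℕ i ]

  before after colouredAfter : Fin n → ℕ
  before        p = ∑[ k < n ] nonInversion k p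
  after         p = ∑[ k < n ] inversion p k
  colouredAfter p = ∑[ k < n ] (nonInversion p k * sgn (zℕ k))

  window-distinct : Distinct (window σ z)
  window-distinct = AllPairs.tabulate⁺ (λ i≢j e → i≢j (⟨$⟩ʳ-injective σ (toℕ-injective e)))

  -- c_{σ p} counts the positions k with k ≤ p and σ k ≤ σ p; the case k = p gives the extra 1.
  codeC-σ : ∀ p → codeC σ (σ ⟨$⟩ʳ p) ≡ suc (before p)
  codeC-σ p = begin
    codeC σ i                                            ≡⟨ length-filter≡sum (Fin._≤? i) (filter Q? (allFin n)) ⟩
    sum (map (λ j → 𝟙 (j Fin.≤? i)) (filter Q? (allFin n))) ≡⟨ sum-map-filter Q? (λ j → 𝟙 (j Fin.≤? i)) (allFin n) ⟩
    sum (map f (allFin n))                               ≡⟨ sum-map-tabulate f (λ j → j) ⟩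
    ∑[ j < n ] f j                                       ≡⟨ ∑-permute f σ ⟩
    ∑[ k < n ] f (σ ⟨$⟩ʳ k)                              ≡⟨ sum-cong-≗ split ⟩
    ∑[ k < n ] (nonInversion k p + 𝟙 (k Fin.≟ p))        ≡⟨ ∑-distrib-+ (λ k → nonInversion k p) (λ k → 𝟙 (k Fin.≟ p)) ⟩
    before p + ∑[ k < n ] 𝟙 (k Fin.≟ p)                  ≡⟨ cong (before p +_) (∑-𝟙-≟ p) ⟩
    before p + 1                                         ≡⟨ +-comm (before p) 1 ⟩
    suc (before p)                                       ∎
    where
      open ≡-Reasoning
      i = σ ⟨$⟩ʳ p
      Q? = λ j → (σ ⟨$⟩ˡ j) Fin.≤? (σ ⟨$⟩ˡ i)
      f : Fin n → ℕ
      f j = 𝟙 (Q? j) * 𝟙 (j Fin.≤? i)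
      split : ∀ k → f (σ ⟨$⟩ʳ k) ≡ nonInversion k p + 𝟙 (k Fin.≟ p)
      split k rewrite inverseˡ σ {k} | inverseˡ σ {p} with k Fin.≟ p
      ... | yes refl rewrite 𝟙-yes (p Fin.≤? p) ≤-refl | 𝟙-yes (i Fin.≤? i) ≤-refl
                           | [<]≡0 (≤-refl {toℕ p}) = refl
      ... | no k≢p = trans (cong₂ _*_ (𝟙-≤?-≢ k≢p) (𝟙-≤?-≢ (λ e → k≢p (⟨$⟩ʳ-injective σ e))))
                           (sym (+-identityʳ _))

  before+after : ∀ p → before p + after p ≡ σℕ p
  before+after p = begin
    before p + after p                           ≡⟨ ∑-distrib-+ (λ k → nonInversion k p) (inversion p) ⟨
    ∑[ k < n ] (nonInversion k p + inversion p k) ≡⟨ sum-cong-≗ merge ⟩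
    ∑[ k < n ] [ σℕ k < σℕ p ]                   ≡⟨ ∑-permute (λ j → [ toℕ j < σℕ p ]) σ ⟨
    ∑[ j < n ] [ toℕ j < σℕ p ]                  ≡⟨ ∑-[<]≡ n (<⇒≤ (toℕ<n (σ ⟨$⟩ʳ p))) ⟩
    σℕ p                                         ∎
    where
      open ≡-Reasoning
      merge : ∀ k → nonInversion k p + inversion p k ≡ [ σℕ k < σℕ p ]
      merge k with <-cmp (toℕ k) (toℕ p)
      ... | tri< k<p _ _ rewrite [<]≡1 k<p | [<]≡0 (<⇒≤ k<p) = trans (+-identityʳ _) (+-identityʳ _)
      ... | tri> _ _ p<k rewrite [<]≡1 p<k | [<]≡0 (<⇒≤ p<k) = +-identityʳ _
      ... | tri≈ _ k≡p _ rewrite toℕ-injective k≡p | [<]≡0 (≤-refl {toℕ p}) | [<]≡0 (≤-refl {σℕ p}) = refl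

  summand-σ : ∀ p → summand σ z (σ ⟨$⟩ʳ p) ≡ zℕ p + after p + 2 * (sgn (zℕ p) * before p)
  summand-σ p = begin
    summand σ z (σ ⟨$⟩ʳ p)
      ≡⟨ cong₂ (λ c e → (suc (σℕ p) ∸ c) + χpos e (2 * (c ∸ 1) + e)) (codeC-σ p) (cong (λ k → toℕ (z k)) (inverseˡ σ)) ⟩
    (σℕ p ∸ before p) + χpos (zℕ p) (2 * before p + zℕ p)
      ≡⟨ cong₂ _+_ (trans (cong (_∸ before p) (sym (before+after p))) (m+n∸m≡n (before p) (after p)))
                   (χpos-+ (zℕ p) (2 * before p)) ⟩
    after p + (sgn (zℕ p) * (2 * before p) + zℕ p)
      ≡⟨ solve 4 (λ a s b e → a :+ (s :* (con 2 :* b) :+ e) := e :+ a :+ con 2 :* (s :* b)) refl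
           (after p) (sgn (zℕ p)) (before p) (zℕ p) ⟩
    zℕ p + after p + 2 * (sgn (zℕ p) * before p) ∎
    where open ≡-Reasoning

  ∑-sgn*before : ∑[ p < n ] (sgn (zℕ p) * before p) ≡ ∑[ k < n ] colouredAfter k
  ∑-sgn*before = begin
    ∑[ p < n ] (sgn (zℕ p) * before p)
      ≡⟨ sum-cong-≗ (λ p → *-distribˡ-sum (sgn (zℕ p)) (λ k → nonInversion k p)) ⟩
    ∑[ p < n ] ∑[ k < n ] (sgn (zℕ p) * nonInversion k p)
      ≡⟨ ∑-comm (λ p k → sgn (zℕ p) * nonInversion k p) ⟩
    ∑[ k < n ] ∑[ p < n ] (sgn (zℕ p) * nonInversion k p)
      ≡⟨ sum-cong-≗ (λ k → sum-cong-≗ (λ p → *-comm (sgn (zℕ p)) (nonInversion k p))) ⟩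
    ∑[ k < n ] colouredAfter k ∎
    where open ≡-Reasoning

  lengthFormula≡weight : lengthFormula n r σ z ≡ weight (window σ z)
  lengthFormula≡weight = begin
    lengthFormula n r σ z                ≡⟨ sum-map-tabulate (summand σ z) (λ i → i) ⟩
    ∑[ i < n ] summand σ z i             ≡⟨ ∑-permute (summand σ z) σ ⟩
    ∑[ p < n ] summand σ z (σ ⟨$⟩ʳ p)    ≡⟨ sum-cong-≗ summand-σ ⟩
    ∑[ p < n ] (base p + 2 * (sgn (zℕ p) * before p))
      ≡⟨ ∑-distrib-+ base (λ p → 2 * (sgn (zℕ p) * before p)) ⟩
    ∑[ p < n ] base p + ∑[ p < n ] (2 * (sgn (zℕ p) * before p))
      ≡⟨ cong (∑[ p < n ] base p +_) (*-distribˡ-sum 2 (λ p → sgn (zℕ p) * before p)) ⟨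
    ∑[ p < n ] base p + 2 * ∑[ p < n ] (sgn (zℕ p) * before p)
      ≡⟨ cong (λ t → ∑[ p < n ] base p + 2 * t) ∑-sgn*before ⟩
    ∑[ p < n ] base p + 2 * ∑[ p < n ] colouredAfter p
      ≡⟨ cong (∑[ p < n ] base p +_) (*-distribˡ-sum 2 colouredAfter) ⟩
    ∑[ p < n ] base p + ∑[ p < n ] (2 * colouredAfter p)
      ≡⟨ ∑-distrib-+ base (λ p → 2 * colouredAfter p) ⟨
    ∑[ p < n ] positionWeight (λ k → σ ⟨$⟩ʳ k , z k) p
      ≡⟨ weight-tabulate (λ k → σ ⟨$⟩ʳ k , z k) ⟨
    weight (window σ z)                    ∎
    where
      open ≡-Reasoning
      base : Fin n → ℕ
      base p = zℕ p + after p

weight-isLength : ∀ {n r} .{{_ : NonZero r}} (w : Window n r) → Distinct w → IsLength n r w (weight w)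
weight-isLength w dis =
  hasWord-weight _ w dis refl ,
  λ ws ws≡w → subst (λ v → weight v ≤ length ws) ws≡w (weight-wordWindow-≤ ws)

lemma3p1 : (r n : ℕ) .{{_ : NonZero r}} (σ : Permutation′ n) (z : Fin n → Fin r) →
    IsLength n r (window σ z) (lengthFormula n r σ z)
lemma3p1 r n σ z rewrite lengthFormula≡weight σ z = weight-isLength (window σ z) (window-distinct σ z)
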